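{- Let $\Gamma$ be a finite group, $S\subseteq\Gamma$, $g\geq 2$, and $\Sigma$ an $|S|$-list of elements of $\Gamma$. If there exists an $RSM_\Gamma(S,g;\Sigma)$, then there exists an $RSM_\Gamma(S,g+i;\Sigma)$ in each of the following cases: (1) $S=-S$ and $i\geq 2$ is even; or (2) $S=\Gamma$, $\Gamma$ has a complete mapping, and $i\geq 1$.
   Context: Groups are written additively (not necessarily abelian). A list is a multiset. For $S\subseteq\Gamma$, an $|S|$-list $\Sigma$ of elements of $\Gamma$ and an integer $g\ge 2$, a row-sum matrix $RSM_\Gamma(S,g;\Sigma)$ is an $|S|\times g$ matrix with entries in $\Gamma$ each of whose columns is a permutation of $S$ (contains each element of $S$ exactly once), and such that the multiset of left-to-right row sums $x_1+x_2+\cdots+x_g$ is $\Sigma$. $-S=\{ -s: s\in S\}$. A complete mapping of $\Gamma$ is a permutation $\pi$ of $\Gamma$ such that $x\mapsto x+\pi(x)$ is also a permutation of $\Gamma$. -}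

module Defs where

open import Level using (0ℓ)
open import Data.Nat using (ℕ)
open import Data.Fin using (Fin)
open import Data.List using (List; length; map; foldr)
open import Data.List.Membership.Propositional using (_∈_)
open import Data.List.Relation.Binary.Permutation.Propositional using (_↭_)
open import Data.Product using (Σ-syntax; _×_)
open import Data.Vec.Functional using (toList)
open import Algebra.Structures using (IsGroup)
open import Function.Definitions using (Bijective)
open import Relation.Binary.PropositionalEquality using (_≡_)

-- A finite group of order n, presented (up to isomorphism) on the carrier Fin n,
-- with propositional equality.  Written additively (not necessarily abelian).
record FinGroup (n : ℕ) : Set where
  field
    _+_     : Fin n → Fin n → Fin n
    0#      : Fin n
    -_      : Fin n → Fin n
    isGroup : IsGroup _≡_ _+_ 0# -_
  infixl 6 _+_
  infix 8 -_

module _ {n : ℕ} (Γ : FinGroup n) where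
  open FinGroup Γ

  rowSum : {g : ℕ} → (Fin g → Fin n) → Fin n
  rowSum x = foldr _+_ 0# (toList x)

  -- RSM_Γ(S, g; Σ): an |S| × g matrix each of whose columns is a permutation of S
  -- and whose multiset of row sums is Σ.  S is given as a duplicate-free list.
  RSM : (S : List (Fin n)) (g : ℕ) (Σl : List (Fin n)) → Set
  RSM S g Σl =
    Σ[ M ∈ (Fin (length S) → Fin g → Fin n) ]
      ((∀ (j : Fin g) → toList (λ i → M i j) ↭ S)
      × (toList (λ i → rowSum (M i)) ↭ Σl))

  neg : List (Fin n) → List (Fin n)
  neg S = map -_ S

  IsCompleteMapping : (Fin n → Fin n) → Set
  IsCompleteMapping π = Bijective _≡_ _≡_ π × Bijective _≡_ _≡_ (λ x → x + π x)

  HasCompleteMapping : Set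
  HasCompleteMapping = Σ[ π ∈ (Fin n → Fin n) ] IsCompleteMapping π

_≐_ : {A : Set} → List A → List A → Set
_≐_ {A} xs ys = (∀ (x : A) → x ∈ xs → x ∈ ys) × (∀ (x : A) → x ∈ ys → x ∈ xs)

{-# OPTIONS --safe #-}
module Submission where

-- Every new matrix is obtained by rearranging the columns of an RSM and applying to
-- each column a permutation of S, which keeps columns permutations of S; only the row
-- sums need care.  If S = -S, the first column a is replaced by a, -a, a: the inserted
-- pair contributes a + (-a) = 0 to each row.  If S = Γ and π is a complete mapping,
-- θ x = x + π x is bijective and each entry a of the first column is split into
-- θ⁻¹ a and π (θ⁻¹ a), whose sum is a.  Iterating gives all even i, resp. all i ≥ 1.

open import Defs
open import Data.Nat using (ℕ; _≤_; _+_; _*_; zero; suc)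
open import Data.Nat.Properties using (+-comm; +-assoc; *-identityʳ; ≤-trans; m≤n+m; <⇒≤)
open import Data.Nat.Divisibility using (_∣_; divides)
open import Data.Fin using (Fin; zero; suc)
open import Data.List using (List; length; map)
open import Data.List.Properties using (tabulate-cong; map-tabulate)
open import Data.List.Membership.Propositional using (_∈_)
open import Data.List.Membership.Propositional.Properties using (∈-map⁺; ∈-map⁻)
open import Data.List.Membership.Propositional.Properties.WithK using (unique∧set⇒bag)
open import Data.List.Relation.Unary.Unique.Propositional using (Unique)
import Data.List.Relation.Unary.Unique.Propositional.Properties as Unique
open import Data.List.Relation.Binary.Permutation.Propositional using (_↭_; ↭-sym; ↭⇒↭ₛ)
open import Data.List.Relation.Binary.Permutation.Propositional.Properties using (∈-resp-↭)
import Data.List.Relation.Binary.Permutation.Setoid.Properties as Permutationₛ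
open import Data.List.Relation.Binary.BagAndSetEquality using (∼bag⇒↭)
open import Data.Vec.Functional using (toList)
open import Data.Product using (_×_; _,_; proj₁; proj₂; ∃-syntax)
open import Data.Sum using (_⊎_; inj₁; inj₂)
open import Algebra.Bundles using (Group)
open import Algebra.Structures using (IsGroup)
import Algebra.Properties.Group as GroupProperties
open import Function using (id; _∘_)
open import Function.Bundles using (mk⇔; mk⤖; Bijection; Inverse)
open import Function.Definitions using (Injective; Bijective)
open import Function.Properties.Bijection using (⤖⇒↔)
open import Function.Properties.Inverse using (↔-sym; Inverse⇒Bijection)
import Function.Construct.Composition as Compose
open import Relation.Binary.PropositionalEquality

module _ {A : Set} where

  record _Permutes_ (f : A → A) (S : List A) : Set where
    field
      injective : Injective _≡_ _≡_ f
      into      : ∀ {x} → x ∈ S → f x ∈ S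
      onto      : ∀ {y} → y ∈ S → ∃[ x ] x ∈ S × y ≡ f x

  id-permutes : ∀ {S} → id Permutes S
  id-permutes = record { injective = id ; into = id ; onto = λ {y} y∈S → y , y∈S , refl }

  bijective-permutes-complete : ∀ {f S} → Bijective _≡_ _≡_ f → (∀ x → x ∈ S) → f Permutes S
  bijective-permutes-complete (f-inj , f-surj) complete = record
    { injective = f-inj
    ; into      = λ _ → complete _
    ; onto      = λ {y} _ → proj₁ (f-surj y) , complete _ , sym (proj₂ (f-surj y) refl)
    }

  Unique-resp-↭ : ∀ {xs ys : List A} → xs ↭ ys → Unique xs → Unique ys
  Unique-resp-↭ p = Permutationₛ.Unique-resp-↭ (setoid A) (↭⇒↭ₛ p)

  -- Both sides are duplicate-free with the same elements, hence are permutations of each other.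
  map-permutes-↭ : ∀ {f S xs} → Unique S → f Permutes S → xs ↭ S → map f xs ↭ S
  map-permutes-↭ {f} {S} {xs} uniqueS f-perm xs↭S =
    ∼bag⇒↭ (unique∧set⇒bag unique-fxs uniqueS (mk⇔ into onto))
    where
    open _Permutes_ f-perm using (injective) renaming (into to f-into; onto to f-onto)
    unique-fxs : Unique (map f xs)
    unique-fxs = Unique.map⁺ injective (Unique-resp-↭ (↭-sym xs↭S) uniqueS)
    into : ∀ {z} → z ∈ map f xs → z ∈ S
    into z∈fxs with x , x∈xs , refl ← ∈-map⁻ f z∈fxs = f-into (∈-resp-↭ xs↭S x∈xs)
    onto : ∀ {z} → z ∈ S → z ∈ map f xs
    onto z∈S with x , x∈S , refl ← f-onto z∈S = ∈-map⁺ f (∈-resp-↭ (↭-sym xs↭S) x∈S)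

iterate-steps : {P : ℕ → Set} (k : ℕ) → (∀ {g} → 1 ≤ g → P g → P (k + g)) →
  ∀ q {g} → 1 ≤ g → P g → P (q * k + g)
iterate-steps k step zero      g≥1 p = p
iterate-steps {P} k step (suc q) {g} g≥1 p =
  subst P (sym (+-assoc k (q * k) g))
    (step (≤-trans g≥1 (m≤n+m g (q * k))) (iterate-steps k step q g≥1 p))

module _ {n : ℕ} (Γ : FinGroup n) where
  open FinGroup Γ renaming (_+_ to _⊕_)

  group : Group _ _
  group = record { isGroup = isGroup }

  open GroupProperties group using (⁻¹-injective; \\-leftDividesˡ)

  neg-permutes : ∀ {S} → S ≐ neg Γ S → -_ Permutes S
  neg-permutes (S⊆-S , -S⊆S) = record
    { injective = ⁻¹-injective
    ; into      = λ x∈S → -S⊆S _ (∈-map⁺ -_ x∈S)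
    ; onto      = λ y∈S → ∈-map⁻ -_ (S⊆-S _ y∈S)
    }

  module _ {S : List (Fin n)} {Σl : List (Fin n)} (uniqueS : Unique S) where

    RSM-recolumn : ∀ {g g′} ((M , columns , _) : RSM Γ S g Σl)
      (c : Fin g′ → Fin g) (σ : Fin g′ → Fin n → Fin n) → (∀ j → σ j Permutes S) →
      (∀ i → rowSum Γ (λ j → σ j (M i (c j))) ≡ rowSum Γ (M i)) → RSM Γ S g′ Σl
    RSM-recolumn (M , columns , rows) c σ σ-perm same-rows =
      (λ i j → σ j (M i (c j))) , columns′ , subst (_↭ Σl) (sym (tabulate-cong same-rows)) rows
      where
      columns′ : ∀ j → toList (λ i → σ j (M i (c j))) ↭ S
      columns′ j = subst (_↭ S) (map-tabulate (λ i → M i (c j)) (σ j))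
        (map-permutes-↭ uniqueS (σ-perm j) (columns (c j)))

    RSM-add-two : S ≐ neg Γ S → ∀ {g} → 1 ≤ g → RSM Γ S g Σl → RSM Γ S (2 + g) Σl
    RSM-add-two S≐-S {suc g} _ M =
      RSM-recolumn M c σ σ-perm (λ i → \\-leftDividesˡ (proj₁ M i zero) _)
      where
      c : Fin (3 + g) → Fin (suc g)
      c zero          = zero
      c (suc zero)    = zero
      c (suc (suc j)) = j
      σ : Fin (3 + g) → Fin n → Fin n
      σ zero          = id
      σ (suc zero)    = -_
      σ (suc (suc j)) = id
      σ-perm : ∀ j → σ j Permutes S
      σ-perm zero          = id-permutes
      σ-perm (suc zero)    = neg-permutes S≐-S
      σ-perm (suc (suc j)) = id-permutes

    RSM-add-one : (∀ x → x ∈ S) → HasCompleteMapping Γ →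
      ∀ {g} → 1 ≤ g → RSM Γ S g Σl → RSM Γ S (1 + g) Σl
    RSM-add-one complete (π , (π-bij , θ-bij)) {suc g} _ M =
      RSM-recolumn M c σ σ-perm same-rows
      where
      open IsGroup isGroup using (assoc)
      θ⁻¹ : Inverse (setoid (Fin n)) (setoid (Fin n))
      θ⁻¹ = ↔-sym (⤖⇒↔ (mk⤖ θ-bij))
      open Inverse θ⁻¹ using () renaming (to to split; strictlyInverseʳ to split-sum)
      split-bij : Bijective _≡_ _≡_ split
      split-bij = Bijection.bijective (Inverse⇒Bijection θ⁻¹)
      c : Fin (2 + g) → Fin (suc g)
      c zero          = zero
      c (suc zero)    = zero
      c (suc (suc j)) = suc j
      σ : Fin (2 + g) → Fin n → Fin n
      σ zero          = split
      σ (suc zero)    = π ∘ split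
      σ (suc (suc j)) = id
      σ-perm : ∀ j → σ j Permutes S
      σ-perm zero          = bijective-permutes-complete split-bij complete
      σ-perm (suc zero)    =
        bijective-permutes-complete (Compose.bijective _≡_ _≡_ _≡_ split-bij π-bij) complete
      σ-perm (suc (suc j)) = id-permutes
      same-rows : ∀ i → rowSum Γ (λ j → σ j (proj₁ M i (c j))) ≡ rowSum Γ (proj₁ M i)
      same-rows i = let a = proj₁ M i zero ; rest = rowSum Γ (proj₁ M i ∘ suc) in begin
        split a ⊕ (π (split a) ⊕ rest) ≡⟨ sym (assoc (split a) (π (split a)) rest) ⟩
        (split a ⊕ π (split a)) ⊕ rest ≡⟨ cong (_⊕ rest) (split-sum a) ⟩
        a ⊕ rest                       ∎
        where open ≡-Reasoning

theorem2p6 : {n : ℕ} (Γ : FinGroup n) (S : List (Fin n)) → Unique S →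
    (g : ℕ) → 2 ≤ g → (Σl : List (Fin n)) → length Σl ≡ length S →
    RSM Γ S g Σl → (i : ℕ) →
    ((S ≐ neg Γ S × 2 ≤ i × 2 ∣ i)
      ⊎ ((∀ (x : Fin n) → x ∈ S) × HasCompleteMapping Γ × 1 ≤ i)) →
    RSM Γ S (g + i) Σl
theorem2p6 Γ S uniqueS g g≥2 Σl _ M _ (inj₁ (S≐-S , _ , divides q refl)) =
  subst (λ h → RSM Γ S h Σl) (+-comm (q * 2) g)
    (iterate-steps 2 (RSM-add-two Γ uniqueS S≐-S) q (<⇒≤ g≥2) M)
theorem2p6 Γ S uniqueS g g≥2 Σl _ M i (inj₂ (complete , hasCM , _)) =
  subst (λ h → RSM Γ S h Σl) (trans (cong (_+ g) (*-identityʳ i)) (+-comm i g))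
    (iterate-steps 1 (RSM-add-one Γ uniqueS complete hasCM) i (<⇒≤ g≥2) M)
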